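{- Let $a,b,c,d$ be positive integers such that $a$, $b$ and $cd$ are pairwise coprime, and let $e$ be a positive integer with $(cd,e)=1$. Then $$\frac{(acd)^*_b}{b}+\frac{(abe)^*_c}{c}\equiv\frac{1}{abcd}-\frac{(bcd)^*_a}{a}+\frac{(d-e)(abe)^*_{cd}}{cd}\pmod 1.$$
   Context: For coprime positive integers $u,q$, $u^*_q$ denotes an integer with $uu^*_q\equiv1\pmod q$. A congruence modulo $1$ between rational numbers means their difference is an integer. -}

module Defs where

open import Data.Nat.Base as ℕ using (ℕ)
open import Data.Integer.Base as ℤ using (ℤ; +_)
open import Data.Integer.Divisibility using () renaming (_∣_ to _∣ℤ_)
open import Data.Rational.Base as ℚ using (ℚ)
open import Data.Product using (∃)
open import Relation.Binary.PropositionalEquality using (_≡_)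

IsInvMod : ℕ → ℕ → ℤ → Set
IsInvMod u q x = + q ∣ℤ ((+ u) ℤ.* x ℤ.- ℤ.1ℤ)

_≡₁_ : ℚ → ℚ → Set
p ≡₁ q = ∃ λ (k : ℤ) → p ℚ.- q ≡ k ℚ./ 1
infix 4 _≡₁_

{-# OPTIONS --safe #-}
module Submission where

open import Defs
open import Data.Nat.Base as ℕ using (ℕ; NonZero; suc)
open import Data.Nat.Properties as ℕP using (m*n≢0)
open import Data.Nat.Coprimality as ℕC using (Coprime)
open import Data.Nat.Divisibility as ℕD using ()
open import Data.Nat.Tactic.RingSolver as ℕSolver using ()
open import Data.Integer.Base as ℤ using (ℤ; +_; _*_; _+_; _-_; -_; 1ℤ; ∣_∣)
open import Data.Integer.Properties using (abs-*; pos-*; *-assoc; *-comm; *-distribʳ-+)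
open import Data.Integer.Coprimality as ℤC using ()
open import Data.Integer.Divisibility.Signed
  using (_∣_; divides; ∣ᵤ⇒∣; ∣⇒∣ᵤ; ∣-refl; ∣m∣n⇒∣m+n; ∣m∣n⇒∣m-n; ∣m⇒∣m*n; ∣n⇒∣m*n; *-monoʳ-∣; *-monoˡ-∣)
open import Data.Integer.Tactic.RingSolver using (solve-∀)
open import Data.Rational.Base as ℚ using (toℚᵘ)
open import Data.Rational.Properties using (toℚᵘ-injective; toℚᵘ-fromℚᵘ; toℚᵘ-homo-+; toℚᵘ-homo‿-)
open import Data.Rational.Unnormalised.Base as ℚᵘ using (mkℚᵘ) renaming (_≃_ to _≃ᵘ_)
import Data.Rational.Unnormalised.Properties as ℚᵘP
open import Data.List.Base using (_∷_; [])
open import Data.Product using (_,_; ∃; map₂)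
open import Relation.Binary.PropositionalEquality
  using (_≡_; refl; sym; trans; cong; cong₂; subst; module ≡-Reasoning)

-- Multiplying the difference of the two sides by abcd gives the integer
--   N = acd·x + abd·y + bcd·z − 1 − ab(d − e)·w,
-- and since a, b and cd are pairwise coprime it suffices that each of them divides N.
-- Modulo a and modulo b, N reduces to bcd·z − 1 and acd·x − 1.  Modulo cd only e·N is
-- accessible: e·N ≡ d(abe·y − 1) − (d − e)(abe·w − 1) ≡ 0, and e is invertible modulo cd.

coprime-*ˡ : ∀ {m n k} → Coprime m k → Coprime n k → Coprime (m ℕ.* n) k
coprime-*ˡ {m} m⊥k n⊥k (i∣mn , i∣k) = n⊥k (ℕC.coprime-divisor i⊥m i∣mn , i∣k)
  where
  i⊥m : Coprime _ m
  i⊥m (j∣i , j∣m) = m⊥k (j∣m , ℕD.∣-trans j∣i i∣k)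

ℤ-coprime-*ˡ : ∀ {i j k} → ℤC.Coprime i k → ℤC.Coprime j k → ℤC.Coprime (i * j) k
ℤ-coprime-*ˡ {i} {j} {k} i⊥k j⊥k =
  subst (λ n → Coprime n ∣ k ∣) (sym (abs-* i j)) (coprime-*ˡ i⊥k j⊥k)

coprime-divisor : ∀ {i j k} → ℤC.Coprime i j → i ∣ j * k → i ∣ k
coprime-divisor {i} {j} {k} i⊥j i∣jk = ∣ᵤ⇒∣ (ℤC.coprime-divisor i j k i⊥j (∣⇒∣ᵤ i∣jk))

coprime-∣⇒*∣ : ∀ {i j k} → ℤC.Coprime i j → i ∣ k → j ∣ k → i * j ∣ k
coprime-∣⇒*∣ {i} {j} i⊥j (divides t refl) j∣ti = subst (i * j ∣_) (*-comm i t) (*-monoʳ-∣ i j∣t)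
  where
  j∣t : j ∣ t
  j∣t = coprime-divisor {j} {i} (ℤC.sym {i} {j} i⊥j) (subst (j ∣_) (*-comm t i) j∣ti)

toℚᵘ-/ : ∀ n d .{{_ : NonZero d}} → toℚᵘ (n ℚ./ d) ≃ᵘ n ℚᵘ./ d
toℚᵘ-/ n (suc d) = toℚᵘ-fromℚᵘ (mkℚᵘ n d)

/-≃ᵘ⇒≡ : ∀ {m n p q} .{{_ : NonZero p}} .{{_ : NonZero q}} →
         m ℚᵘ./ p ≃ᵘ n ℚᵘ./ q → m ℚ./ p ≡ n ℚ./ q
/-≃ᵘ⇒≡ {m} {n} {p} {q} eq =
  toℚᵘ-injective (ℚᵘP.≃-trans (toℚᵘ-/ m p) (ℚᵘP.≃-trans eq (ℚᵘP.≃-sym (toℚᵘ-/ n q))))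

/ᵘ-distribʳ-+ : ∀ m n d .{{_ : NonZero d}} → (m + n) ℚᵘ./ d ≃ᵘ m ℚᵘ./ d ℚᵘ.+ n ℚᵘ./ d
/ᵘ-distribʳ-+ m n d@(suc _) = begin
  (m + n) ℚᵘ./ d                       ≈⟨ ℚᵘP.*-cancelʳ-/ d ⟨
  ((m + n) * + d) ℚᵘ./ (d ℕ.* d)        ≡⟨ ℚᵘP./-cong (*-distribʳ-+ (+ d) m n) refl ⟩
  (m * + d + n * + d) ℚᵘ./ (d ℕ.* d)    ≡⟨⟩
  m ℚᵘ./ d ℚᵘ.+ n ℚᵘ./ d                ∎
  where open ℚᵘP.≃-Reasoning

/-distribʳ-+ : ∀ m n d .{{_ : NonZero d}} → (m + n) ℚ./ d ≡ m ℚ./ d ℚ.+ n ℚ./ d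
/-distribʳ-+ m n d = toℚᵘ-injective (begin
  toℚᵘ ((m + n) ℚ./ d)                 ≈⟨ toℚᵘ-/ (m + n) d ⟩
  (m + n) ℚᵘ./ d                       ≈⟨ /ᵘ-distribʳ-+ m n d ⟩
  m ℚᵘ./ d ℚᵘ.+ n ℚᵘ./ d               ≈⟨ ℚᵘP.+-cong (toℚᵘ-/ m d) (toℚᵘ-/ n d) ⟨
  toℚᵘ (m ℚ./ d) ℚᵘ.+ toℚᵘ (n ℚ./ d)   ≈⟨ toℚᵘ-homo-+ (m ℚ./ d) (n ℚ./ d) ⟨
  toℚᵘ (m ℚ./ d ℚ.+ n ℚ./ d)           ∎)
  where open ℚᵘP.≃-Reasoning

neg-distribˡ-/ : ∀ n d .{{_ : NonZero d}} → ℚ.- (n ℚ./ d) ≡ (- n) ℚ./ d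
neg-distribˡ-/ n d@(suc _) = toℚᵘ-injective (begin
  toℚᵘ (ℚ.- (n ℚ./ d))     ≈⟨ toℚᵘ-homo‿- (n ℚ./ d) ⟩
  ℚᵘ.- toℚᵘ (n ℚ./ d)      ≈⟨ ℚᵘP.-‿cong (toℚᵘ-/ n d) ⟩
  (- n) ℚᵘ./ d             ≈⟨ toℚᵘ-/ (- n) d ⟨
  toℚᵘ ((- n) ℚ./ d)       ∎)
  where open ℚᵘP.≃-Reasoning

/-distribʳ-- : ∀ m n d .{{_ : NonZero d}} → (m - n) ℚ./ d ≡ m ℚ./ d ℚ.- n ℚ./ d
/-distribʳ-- m n d = trans (/-distribʳ-+ m (- n) d) (cong (m ℚ./ d ℚ.+_) (sym (neg-distribˡ-/ n d)))

/-expand : ∀ n m {M q r} .{{_ : NonZero q}} .{{_ : NonZero r}} →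
           + m ≡ M → m ℕ.* q ≡ r → n ℚ./ q ≡ (M * n) ℚ./ r
/-expand n m refl refl = /-≃ᵘ⇒≡ (ℚᵘP.≃-sym (ℚᵘP.*-cancelˡ-/ m))

∣⇒/-integral : ∀ {m n} .{{_ : NonZero n}} → + n ∣ m → ∃ λ k → m ℚ./ n ≡ k ℚ./ 1
∣⇒/-integral {n = n} (divides k refl) =
  k , trans (cong (ℚ._/ n) (*-comm k (+ n))) (sym (/-expand k n refl (ℕP.*-identityʳ n)))

pos-*³ : ∀ m n k → + (m ℕ.* n ℕ.* k) ≡ + m * + n * + k
pos-*³ m n k = trans (pos-* (m ℕ.* n) k) (cong (_* + k) (pos-* m n))

coprime-pos : ∀ {m n M N} → + m ≡ M → + n ≡ N → Coprime m n → ℤC.Coprime M N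
coprime-pos refl refl m⊥n = m⊥n

isInvMod-pos : ∀ {u q x U Q} → + u ≡ U → + q ≡ Q → IsInvMod u q x → Q ∣ U * x - 1ℤ
isInvMod-pos refl refl ux≡1 = ∣ᵤ⇒∣ ux≡1

discrepancy : (A B C D E x y z w : ℤ) → ℤ
discrepancy A B C D E x y z w =
  (A * C * D * x + A * B * D * y) - ((1ℤ - B * C * D * z) + A * B * ((D - E) * w))

abcd∣discrepancy : ∀ {A B C D E} x y z w
  → ℤC.Coprime A B → ℤC.Coprime A (C * D) → ℤC.Coprime B (C * D) → ℤC.Coprime (C * D) E
  → B ∣ A * C * D * x - 1ℤ → C ∣ A * B * E * y - 1ℤ
  → A ∣ B * C * D * z - 1ℤ → C * D ∣ A * B * E * w - 1ℤ
  → A * B * C * D ∣ discrepancy A B C D E x y z w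
abcd∣discrepancy {A} {B} {C} {D} {E} x y z w A⊥B A⊥CD B⊥CD CD⊥E x⁻ y⁻ z⁻ w⁻ =
  subst (_∣ N) (sym (*-assoc (A * B) C D)) (coprime-∣⇒*∣ {A * B} {C * D} AB⊥CD AB∣N CD∣N)
  where
  N = discrepancy A B C D E x y z w

  -- The ring solver does not unfold discrepancy, so the identities below spell it out.
  A∣N : A ∣ N
  A∣N = subst (A ∣_) (N-mod-A A B C D E x y z w) (∣m∣n⇒∣m+n z⁻ (∣m⇒∣m*n _ ∣-refl))
    where
    N-mod-A : ∀ A B C D E x y z w →
      (B * C * D * z - 1ℤ) + A * (C * D * x + B * D * y - B * ((D - E) * w))
        ≡ (A * C * D * x + A * B * D * y) - ((1ℤ - B * C * D * z) + A * B * ((D - E) * w))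
    N-mod-A = solve-∀

  B∣N : B ∣ N
  B∣N = subst (B ∣_) (N-mod-B A B C D E x y z w) (∣m∣n⇒∣m+n x⁻ (∣m⇒∣m*n _ ∣-refl))
    where
    N-mod-B : ∀ A B C D E x y z w →
      (A * C * D * x - 1ℤ) + B * (A * D * y + C * D * z - A * ((D - E) * w))
        ≡ (A * C * D * x + A * B * D * y) - ((1ℤ - B * C * D * z) + A * B * ((D - E) * w))
    N-mod-B = solve-∀

  CD∣EN : C * D ∣ E * N
  CD∣EN = subst (C * D ∣_) (EN-mod-CD A B C D E x y z w)
    (∣m∣n⇒∣m+n (∣m∣n⇒∣m-n (*-monoˡ-∣ D y⁻) (∣n⇒∣m*n (D - E) w⁻)) (∣m⇒∣m*n _ ∣-refl))
    where
    EN-mod-CD : ∀ A B C D E x y z w →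
      (A * B * E * y - 1ℤ) * D - (D - E) * (A * B * E * w - 1ℤ) + C * D * (E * A * x + E * B * z)
        ≡ E * ((A * C * D * x + A * B * D * y) - ((1ℤ - B * C * D * z) + A * B * ((D - E) * w)))
    EN-mod-CD = solve-∀

  CD∣N : C * D ∣ N
  CD∣N = coprime-divisor {C * D} {E} CD⊥E CD∣EN

  AB∣N : A * B ∣ N
  AB∣N = coprime-∣⇒*∣ {A} {B} A⊥B A∣N B∣N

  AB⊥CD : ℤC.Coprime (A * B) (C * D)
  AB⊥CD = ℤ-coprime-*ˡ {A} {B} {C * D} A⊥CD B⊥CD

/-combine : ∀ X Y Z W q .{{_ : NonZero q}} →
  ((X + Y) - ((1ℤ - Z) + W)) ℚ./ q
    ≡ (X ℚ./ q ℚ.+ Y ℚ./ q) ℚ.- ((1ℤ ℚ./ q ℚ.- Z ℚ./ q) ℚ.+ W ℚ./ q)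
/-combine X Y Z W q = begin
  ((X + Y) - ((1ℤ - Z) + W)) ℚ./ q
    ≡⟨ /-distribʳ-- (X + Y) ((1ℤ - Z) + W) q ⟩
  (X + Y) ℚ./ q ℚ.- ((1ℤ - Z) + W) ℚ./ q
    ≡⟨ cong₂ ℚ._-_ (/-distribʳ-+ X Y q) (/-distribʳ-+ (1ℤ - Z) W q) ⟩
  (X ℚ./ q ℚ.+ Y ℚ./ q) ℚ.- ((1ℤ - Z) ℚ./ q ℚ.+ W ℚ./ q)
    ≡⟨ cong (λ t → (X ℚ./ q ℚ.+ Y ℚ./ q) ℚ.- (t ℚ.+ W ℚ./ q)) (/-distribʳ-- 1ℤ Z q) ⟩
  (X ℚ./ q ℚ.+ Y ℚ./ q) ℚ.- ((1ℤ ℚ./ q ℚ.- Z ℚ./ q) ℚ.+ W ℚ./ q) ∎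
  where open ≡-Reasoning

difference≡discrepancy/abcd : ∀ a b c d e .{{_ : NonZero a}} .{{_ : NonZero b}} .{{_ : NonZero c}}
  .{{_ : NonZero (a ℕ.* b ℕ.* c ℕ.* d)}} .{{_ : NonZero (c ℕ.* d)}} (x y z w : ℤ) →
  (x ℚ./ b ℚ.+ y ℚ./ c) ℚ.- ((1ℤ ℚ./ (a ℕ.* b ℕ.* c ℕ.* d) ℚ.- z ℚ./ a) ℚ.+ ((+ d - + e) * w) ℚ./ (c ℕ.* d))
    ≡ discrepancy (+ a) (+ b) (+ c) (+ d) (+ e) x y z w ℚ./ (a ℕ.* b ℕ.* c ℕ.* d)
difference≡discrepancy/abcd a b c d e x y z w = begin
  (x ℚ./ b ℚ.+ y ℚ./ c) ℚ.- ((1ℤ ℚ./ abcd ℚ.- z ℚ./ a) ℚ.+ ((D - E) * w) ℚ./ (c ℕ.* d))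
    ≡⟨ cong₂ ℚ._-_ (cong₂ ℚ._+_ x/b≡ y/c≡) (cong₂ (λ s t → (1ℤ ℚ./ abcd ℚ.- s) ℚ.+ t) z/a≡ w/cd≡) ⟩
  (A * C * D * x ℚ./ abcd ℚ.+ A * B * D * y ℚ./ abcd)
    ℚ.- ((1ℤ ℚ./ abcd ℚ.- B * C * D * z ℚ./ abcd) ℚ.+ A * B * ((D - E) * w) ℚ./ abcd)
    ≡⟨ /-combine (A * C * D * x) (A * B * D * y) (B * C * D * z) (A * B * ((D - E) * w)) abcd ⟨
  discrepancy A B C D E x y z w ℚ./ abcd ∎
  where
  open ≡-Reasoning
  abcd = a ℕ.* b ℕ.* c ℕ.* d
  A = + a ; B = + b ; C = + c ; D = + d ; E = + e
  acd·b : a ℕ.* c ℕ.* d ℕ.* b ≡ a ℕ.* b ℕ.* c ℕ.* d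
  acd·b = ℕSolver.solve (a ∷ b ∷ c ∷ d ∷ [])
  abd·c : a ℕ.* b ℕ.* d ℕ.* c ≡ a ℕ.* b ℕ.* c ℕ.* d
  abd·c = ℕSolver.solve (a ∷ b ∷ c ∷ d ∷ [])
  bcd·a : b ℕ.* c ℕ.* d ℕ.* a ≡ a ℕ.* b ℕ.* c ℕ.* d
  bcd·a = ℕSolver.solve (a ∷ b ∷ c ∷ d ∷ [])
  ab·cd : a ℕ.* b ℕ.* (c ℕ.* d) ≡ a ℕ.* b ℕ.* c ℕ.* d
  ab·cd = ℕSolver.solve (a ∷ b ∷ c ∷ d ∷ [])
  x/b≡ : x ℚ./ b ≡ A * C * D * x ℚ./ abcd
  x/b≡ = /-expand x (a ℕ.* c ℕ.* d) (pos-*³ a c d) acd·b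
  y/c≡ : y ℚ./ c ≡ A * B * D * y ℚ./ abcd
  y/c≡ = /-expand y (a ℕ.* b ℕ.* d) (pos-*³ a b d) abd·c
  z/a≡ : z ℚ./ a ≡ B * C * D * z ℚ./ abcd
  z/a≡ = /-expand z (b ℕ.* c ℕ.* d) (pos-*³ b c d) bcd·a
  w/cd≡ : (D - E) * w ℚ./ (c ℕ.* d) ≡ A * B * ((D - E) * w) ℚ./ abcd
  w/cd≡ = /-expand ((D - E) * w) (a ℕ.* b) (pos-* a b) ab·cd

lemma12 : (a b c d e : ℕ) → .{{_ : NonZero a}} → .{{_ : NonZero b}}
          → .{{_ : NonZero c}} → .{{_ : NonZero d}} → .{{_ : NonZero e}}
          → Coprime a b → Coprime a (c ℕ.* d) → Coprime b (c ℕ.* d)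
          → Coprime (c ℕ.* d) e
          → (x y z w : ℤ)
          → IsInvMod (a ℕ.* c ℕ.* d) b x
          → IsInvMod (a ℕ.* b ℕ.* e) c y
          → IsInvMod (b ℕ.* c ℕ.* d) a z
          → IsInvMod (a ℕ.* b ℕ.* e) (c ℕ.* d) w
          → (x ℚ./ b) ℚ.+ (y ℚ./ c)
            ≡₁ ℚ._/_ ℤ.1ℤ (a ℕ.* b ℕ.* c ℕ.* d)
                 {{m*n≢0 (a ℕ.* b ℕ.* c) d {{m*n≢0 (a ℕ.* b) c {{m*n≢0 a b}}}}}} ℚ.- (z ℚ./ a)
               ℚ.+ ℚ._/_ (((+ d) ℤ.- (+ e)) ℤ.* w) (c ℕ.* d) {{m*n≢0 c d}}
lemma12 a b c d e a⊥b a⊥cd b⊥cd cd⊥e x y z w x⁻ y⁻ z⁻ w⁻ =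
  map₂ (trans (difference≡discrepancy/abcd a b c d e x y z w)) (∣⇒/-integral abcd∣N)
  where
  instance
    abcd≢0 : NonZero (a ℕ.* b ℕ.* c ℕ.* d)
    abcd≢0 = m*n≢0 (a ℕ.* b ℕ.* c) d {{m*n≢0 (a ℕ.* b) c {{m*n≢0 a b}}}}
    cd≢0 : NonZero (c ℕ.* d)
    cd≢0 = m*n≢0 c d
  CD : + (c ℕ.* d) ≡ + c * + d
  CD = pos-* c d
  ABCD : + (a ℕ.* b ℕ.* c ℕ.* d) ≡ + a * + b * + c * + d
  ABCD = trans (pos-* (a ℕ.* b ℕ.* c) d) (cong (_* + d) (pos-*³ a b c))
  N = discrepancy (+ a) (+ b) (+ c) (+ d) (+ e) x y z w
  abcd∣N : + (a ℕ.* b ℕ.* c ℕ.* d) ∣ N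
  abcd∣N = subst (_∣ N) (sym ABCD) (abcd∣discrepancy x y z w
    (coprime-pos refl refl a⊥b) (coprime-pos refl CD a⊥cd)
    (coprime-pos refl CD b⊥cd) (coprime-pos CD refl cd⊥e)
    (isInvMod-pos (pos-*³ a c d) refl x⁻) (isInvMod-pos (pos-*³ a b e) refl y⁻)
    (isInvMod-pos (pos-*³ b c d) refl z⁻) (isInvMod-pos (pos-*³ a b e) CD w⁻))
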